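{- In an extensive category all of the following hold. (a) The squares of types (E), (K), (K+), (D) and (D+) are pullbacks. (b) For every object $X$, the two maps $[\mathrm{id},\kappa_2]$ and $[[\kappa_2,\kappa_1],\kappa_2]\colon(X+X)+X\to X+X$ are jointly monic.
   Context: Extensive category: a category with finite coproducts that are disjoint and universal. Disjoint means the coprojections $\kappa_1,\kappa_2$ are monic and their pullback is initial. Universal means that for every $f\colon Z\to X+Y$ the pullbacks $k_i\colon Z_i\to Z$ of $\kappa_i$ along $f$ exist and $[k_1,k_2]\colon Z_1+Z_2\to Z$ is an isomorphism. Notation: $[f,g]$ is the cotuple, $h+k=[\kappa_1\circ h,\kappa_2\circ k]$, and $\nabla=[\mathrm{id},\mathrm{id}]$. (E): for all $f\colon A\to B$ and $g\colon X\to Y$, the square with top $\mathrm{id}+g\colon A+X\to A+Y$, bottom $\mathrm{id}+g\colon B+X\to B+Y$ and verticals $f+\mathrm{id}$. (K): for $f\colon X\to Y$ and an object $A$, the square with top $f$, bottom $f+\mathrm{id}\colon X+A\to Y+A$ and verticals $\kappa_1$. (K+): for $f\colon X\to Y$ and $g\colon A\to B$, the square with top $f$, bottom $f+g$ and verticals $\kappa_1$. (D): for $f\colon X\to Y$, the square with top $f+f\colon X+X\to Y+Y$, bottom $f$ and verticals $\nabla$. (D+): for $f\colon X\to Y$, the square with top $(f+f)+f$, bottom $f+f$ and verticals $\nabla+\mathrm{id}$. Joint monicity: for parallel maps $u,v$ into $(X+X)+X$, if both maps agree after composing with each of the two given maps, then $u=v$. -}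

module Defs where

open import Level using (Level; _⊔_; suc)
open import Data.Product using (Σ; Σ-syntax; _×_; _,_)
open import Relation.Binary using (IsEquivalence)

record Category (o ℓ e : Level) : Set (suc (o ⊔ ℓ ⊔ e)) where
  infixr 9 _∘_
  infix  4 _≈_ _⇒_
  field
    Obj       : Set o
    _⇒_       : Obj → Obj → Set ℓ
    _≈_       : ∀ {A B} → A ⇒ B → A ⇒ B → Set e
    id        : ∀ {A} → A ⇒ A
    _∘_       : ∀ {A B C} → B ⇒ C → A ⇒ B → A ⇒ C
    equiv     : ∀ {A B} → IsEquivalence (_≈_ {A} {B})
    ∘-resp-≈  : ∀ {A B C} {f h : B ⇒ C} {g i : A ⇒ B} → f ≈ h → g ≈ i → f ∘ g ≈ h ∘ i
    assoc     : ∀ {A B C D} {f : A ⇒ B} {g : B ⇒ C} {h : C ⇒ D} → (h ∘ g) ∘ f ≈ h ∘ (g ∘ f)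
    identityˡ : ∀ {A B} {f : A ⇒ B} → id ∘ f ≈ f
    identityʳ : ∀ {A B} {f : A ⇒ B} → f ∘ id ≈ f

module _ {o ℓ e : Level} (C : Category o ℓ e) where
  open Category C

  Monic : ∀ {A B} → A ⇒ B → Set (o ⊔ ℓ ⊔ e)
  Monic {A} m = ∀ {W} (u v : W ⇒ A) → m ∘ u ≈ m ∘ v → u ≈ v

  IsInitial : Obj → Set (o ⊔ ℓ ⊔ e)
  IsInitial I = ∀ B → Σ[ ! ∈ I ⇒ B ] (∀ (g : I ⇒ B) → g ≈ !)

  IsIso : ∀ {A B} → A ⇒ B → Set (ℓ ⊔ e)
  IsIso {A} {B} f = Σ[ g ∈ B ⇒ A ] (g ∘ f ≈ id × f ∘ g ≈ id)

  -- The commutative square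
  --     P --p₂--> Y
  --     |p₁       |g
  --     v         v
  --     X --f---> Z
  -- is a pullback (of the cospan f, g).
  IsPullback : ∀ {P X Y Z} (f : X ⇒ Z) (g : Y ⇒ Z) (p₁ : P ⇒ X) (p₂ : P ⇒ Y)
             → Set (o ⊔ ℓ ⊔ e)
  IsPullback {P} {X} {Y} {Z} f g p₁ p₂ =
    (f ∘ p₁ ≈ g ∘ p₂) ×
    (∀ {Q} (h₁ : Q ⇒ X) (h₂ : Q ⇒ Y) → f ∘ h₁ ≈ g ∘ h₂ →
      Σ[ u ∈ Q ⇒ P ] ((p₁ ∘ u ≈ h₁ × p₂ ∘ u ≈ h₂) ×
        (∀ (u' : Q ⇒ P) → p₁ ∘ u' ≈ h₁ → p₂ ∘ u' ≈ h₂ → u' ≈ u)))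

  record FiniteCoproducts : Set (o ⊔ ℓ ⊔ e) where
    infixr 6 _+_
    field
      𝟘         : Obj
      𝟘-initial : IsInitial 𝟘
      _+_       : Obj → Obj → Obj
      κ₁        : ∀ {A B} → A ⇒ A + B
      κ₂        : ∀ {A B} → B ⇒ A + B
      [_,_]     : ∀ {A B C} → A ⇒ C → B ⇒ C → A + B ⇒ C
      inject₁   : ∀ {A B C} {f : A ⇒ C} {g : B ⇒ C} → [ f , g ] ∘ κ₁ ≈ f
      inject₂   : ∀ {A B C} {f : A ⇒ C} {g : B ⇒ C} → [ f , g ] ∘ κ₂ ≈ g
      unique    : ∀ {A B C} {f : A ⇒ C} {g : B ⇒ C} (h : A + B ⇒ C)
                → h ∘ κ₁ ≈ f → h ∘ κ₂ ≈ g → h ≈ [ f , g ]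

    _⊕_ : ∀ {A B C D} → A ⇒ B → C ⇒ D → A + C ⇒ B + D
    h ⊕ k = [ κ₁ ∘ h , κ₂ ∘ k ]

    ∇ : ∀ {A} → A + A ⇒ A
    ∇ = [ id , id ]

  record Extensive : Set (o ⊔ ℓ ⊔ e) where
    field
      coproducts : FiniteCoproducts
    open FiniteCoproducts coproducts
    field
      κ₁-monic : ∀ {A B} → Monic (κ₁ {A} {B})
      κ₂-monic : ∀ {A B} → Monic (κ₂ {A} {B})
      disjoint : ∀ {A B} → Σ[ P ∈ Obj ] Σ[ p₁ ∈ P ⇒ A ] Σ[ p₂ ∈ P ⇒ B ]
                   (IsPullback (κ₁ {A} {B}) κ₂ p₁ p₂ × IsInitial P)
      universal : ∀ {X Y Z} (f : Z ⇒ X + Y) →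
        Σ[ Z₁ ∈ Obj ] Σ[ k₁ ∈ Z₁ ⇒ Z ] Σ[ f₁ ∈ Z₁ ⇒ X ]
        Σ[ Z₂ ∈ Obj ] Σ[ k₂ ∈ Z₂ ⇒ Z ] Σ[ f₂ ∈ Z₂ ⇒ Y ]
          (IsPullback f κ₁ k₁ f₁ × IsPullback f κ₂ k₂ f₂ × IsIso [ k₁ , k₂ ])

  module _ (Ext : Extensive) where
    open Extensive Ext
    open FiniteCoproducts coproducts

    -- (E): top id+g : A+X → A+Y, bottom id+g : B+X → B+Y, verticals f+id.
    SquareE : Set (o ⊔ ℓ ⊔ e)
    SquareE = ∀ {A B X Y} (f : A ⇒ B) (g : X ⇒ Y) →
      IsPullback (f ⊕ id {Y}) (id {B} ⊕ g) (id {A} ⊕ g) (f ⊕ id {X})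

    -- (K): top f, bottom f+id : X+A → Y+A, verticals κ₁.
    SquareK : Set (o ⊔ ℓ ⊔ e)
    SquareK = ∀ {X Y} (f : X ⇒ Y) (A : Obj) →
      IsPullback (κ₁ {Y} {A}) (f ⊕ id {A}) f (κ₁ {X} {A})

    -- (K+): top f, bottom f+g, verticals κ₁.
    SquareK+ : Set (o ⊔ ℓ ⊔ e)
    SquareK+ = ∀ {X Y A B} (f : X ⇒ Y) (g : A ⇒ B) →
      IsPullback (κ₁ {Y} {B}) (f ⊕ g) f (κ₁ {X} {A})

    -- (D): top f+f : X+X → Y+Y, bottom f, verticals ∇.
    SquareD : Set (o ⊔ ℓ ⊔ e)
    SquareD = ∀ {X Y} (f : X ⇒ Y) →
      IsPullback (∇ {Y}) f (f ⊕ f) (∇ {X})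

    -- (D+): top (f+f)+f, bottom f+f, verticals ∇+id.
    SquareD+ : Set (o ⊔ ℓ ⊔ e)
    SquareD+ = ∀ {X Y} (f : X ⇒ Y) →
      IsPullback (∇ {Y} ⊕ id {Y}) (f ⊕ f) ((f ⊕ f) ⊕ f) (∇ {X} ⊕ id {X})

    JointlyMonic : ∀ {A B} → A ⇒ B → A ⇒ B → Set (o ⊔ ℓ ⊔ e)
    JointlyMonic {A} m₁ m₂ = ∀ {W} (u v : W ⇒ A) →
      m₁ ∘ u ≈ m₁ ∘ v → m₂ ∘ u ≈ m₂ ∘ v → u ≈ v

-- Universality says that every h : Q → X + Y splits Q into two parts Q₁, Q₂ which h
-- sends into the two summands; these parts are jointly epic and maps out of Q can be
-- glued from maps out of them (a 'Decomposition' of h). Together with disjointness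
-- (a part landing in both summands is initial, initial objects being strict) this
-- gives the two basic pullbacks (K+): κᵢ pulled back along f ⊕ g is κᵢ.
-- The second basic fact is stability of pullbacks under coproducts: pulling f back
-- along a cotuple [α , β] yields the coproduct of the pullbacks along α and along β.
-- Pasting it with (K+) shows that a coproduct f₁ ⊕ f₂ of pullback squares is again a
-- pullback. Then (K) is a special case of (K+), (D) is the cotuple of two trivial
-- pullbacks, and (E) and (D+) are coproducts of (D) and of trivial pullbacks.
-- Joint monicity follows by splitting along the first map: where [id , κ₂] ∘ u lands
-- in the first summand, u is determined by it; where it lands in the second summand,
-- u is determined by [[κ₂ , κ₁] , κ₂] ∘ u.
module Submission where

open import Level using (Level; _⊔_)
open import Data.Product using (_×_; Σ-syntax; _,_; proj₁; proj₂)
open import Relation.Binary using (Setoid; IsEquivalence)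
import Relation.Binary.Reasoning.Setoid as SetoidReasoning
open import Defs

module CategoryFacts {o ℓ e : Level} (C : Category o ℓ e) where
  open Category C

  module HomEquivalence {A B : Obj} = IsEquivalence (equiv {A} {B})
  open HomEquivalence public renaming (refl to ≈-refl; sym to ≈-sym; trans to ≈-trans)

  hom-setoid : Obj → Obj → Setoid ℓ e
  hom-setoid A B = record { Carrier = A ⇒ B ; _≈_ = _≈_ ; isEquivalence = equiv }

  module HomReasoning {A B : Obj} = SetoidReasoning (hom-setoid A B)
  open HomReasoning public

  infixr 4 _⟩∘⟨_ refl⟩∘⟨_
  infixl 5 _⟩∘⟨refl

  _⟩∘⟨_ : ∀ {A B D} {f h : B ⇒ D} {g i : A ⇒ B} → f ≈ h → g ≈ i → f ∘ g ≈ h ∘ i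
  _⟩∘⟨_ = ∘-resp-≈

  refl⟩∘⟨_ : ∀ {A B D} {f : B ⇒ D} {g i : A ⇒ B} → g ≈ i → f ∘ g ≈ f ∘ i
  refl⟩∘⟨ p = ≈-refl ⟩∘⟨ p

  _⟩∘⟨refl : ∀ {A B D} {f h : B ⇒ D} {g : A ⇒ B} → f ≈ h → f ∘ g ≈ h ∘ g
  p ⟩∘⟨refl = p ⟩∘⟨ ≈-refl

  sym-assoc : ∀ {A B D E} {f : A ⇒ B} {g : B ⇒ D} {h : D ⇒ E} → h ∘ (g ∘ f) ≈ (h ∘ g) ∘ f
  sym-assoc = ≈-sym assoc

  pullˡ : ∀ {A B D E} {f : D ⇒ E} {g : B ⇒ D} {h : B ⇒ E} {x : A ⇒ B}
        → f ∘ g ≈ h → f ∘ (g ∘ x) ≈ h ∘ x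
  pullˡ p = ≈-trans sym-assoc (p ⟩∘⟨refl)

  extendʳ : ∀ {A B B' D E} {f : D ⇒ E} {g : B ⇒ D} {h : B' ⇒ E} {k : B ⇒ B'} {x : A ⇒ B}
          → f ∘ g ≈ h ∘ k → f ∘ (g ∘ x) ≈ h ∘ (k ∘ x)
  extendʳ p = ≈-trans sym-assoc (≈-trans (p ⟩∘⟨refl) assoc)

  split-epi-cancel : ∀ {A B D} {f : A ⇒ B} {g : B ⇒ A} → f ∘ g ≈ id
                   → (x y : B ⇒ D) → x ∘ f ≈ y ∘ f → x ≈ y
  split-epi-cancel {f = f} {g} fg x y xf≈yf = begin
    x             ≈⟨ ≈-sym identityʳ ⟩
    x ∘ id        ≈⟨ refl⟩∘⟨ ≈-sym fg ⟩
    x ∘ (f ∘ g)   ≈⟨ pullˡ xf≈yf ⟩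
    (y ∘ f) ∘ g   ≈⟨ assoc ⟩
    y ∘ (f ∘ g)   ≈⟨ refl⟩∘⟨ fg ⟩
    y ∘ id        ≈⟨ identityʳ ⟩
    y             ∎

  initial-unique : ∀ {I B} → IsInitial C I → (a b : I ⇒ B) → a ≈ b
  initial-unique {B = B} init a b = ≈-trans (proj₂ (init B) a) (≈-sym (proj₂ (init B) b))

  Factorisation : ∀ {P X Y Q} (p : P ⇒ X) (q : P ⇒ Y) (h : Q ⇒ X) (k : Q ⇒ Y) → Set (ℓ ⊔ e)
  Factorisation {P} {Q = Q} p q h k = Σ[ u ∈ Q ⇒ P ] (p ∘ u ≈ h × q ∘ u ≈ k)

  JointlyMonicSpan : ∀ {P X Y} (p : P ⇒ X) (q : P ⇒ Y) → Set (o ⊔ ℓ ⊔ e)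
  JointlyMonicSpan {P} p q = ∀ {Q} (s t : Q ⇒ P) → p ∘ s ≈ p ∘ t → q ∘ s ≈ q ∘ t → s ≈ t

  pullback-intro : ∀ {P X Y Z} {f : X ⇒ Z} {g : Y ⇒ Z} {p : P ⇒ X} {q : P ⇒ Y}
    → f ∘ p ≈ g ∘ q
    → (∀ {Q} (h : Q ⇒ X) (k : Q ⇒ Y) → f ∘ h ≈ g ∘ k → Factorisation p q h k)
    → JointlyMonicSpan p q
    → IsPullback C f g p q
  pullback-intro commutes factor separates = commutes , λ h k eq →
    let (u , pu≈h , qu≈k) = factor h k eq in
    u , (pu≈h , qu≈k) , λ u' pu'≈h qu'≈k →
      separates u' u (≈-trans pu'≈h (≈-sym pu≈h)) (≈-trans qu'≈k (≈-sym qu≈k))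

  pullback-factor : ∀ {P X Y Z Q} {f : X ⇒ Z} {g : Y ⇒ Z} {p : P ⇒ X} {q : P ⇒ Y}
    → IsPullback C f g p q → {h : Q ⇒ X} {k : Q ⇒ Y} → f ∘ h ≈ g ∘ k → Factorisation p q h k
  pullback-factor (_ , universal) eq =
    let (u , factorises , _) = universal _ _ eq in u , factorises

  pullback-separates : ∀ {P X Y Z} {f : X ⇒ Z} {g : Y ⇒ Z} {p : P ⇒ X} {q : P ⇒ Y}
    → IsPullback C f g p q → JointlyMonicSpan p q
  pullback-separates {p = p} {q} (commutes , universal) s t ps≈pt qs≈qt =
    let (_ , _ , unique) = universal (p ∘ s) (q ∘ s) (extendʳ commutes)
    in ≈-trans (unique s ≈-refl ≈-refl) (≈-sym (unique t (≈-sym ps≈pt) (≈-sym qs≈qt)))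

  identity-pullback : ∀ {X Y} {f : X ⇒ Y} → IsPullback C f id id f
  identity-pullback =
    pullback-intro (≈-trans identityʳ (≈-sym identityˡ))
      (λ h k fh≈k → h , identityˡ , ≈-trans fh≈k identityˡ)
      (λ s t ids≈idt _ → ≈-trans (≈-sym identityˡ) (≈-trans ids≈idt identityˡ))

  pullback-swap : ∀ {P X Y Z} {f : X ⇒ Z} {g : Y ⇒ Z} {p : P ⇒ X} {q : P ⇒ Y}
    → IsPullback C f g p q → IsPullback C g f q p
  pullback-swap pb =
    pullback-intro (≈-sym (proj₁ pb))
      (λ h k eq → let (u , pu , qu) = pullback-factor pb (≈-sym eq) in u , qu , pu)
      (λ s t qs≈qt ps≈pt → pullback-separates pb s t ps≈pt qs≈qt)

  pullback-paste : ∀ {P X Y Z Y' W} {f : X ⇒ Z} {g : Y ⇒ Z} {p : P ⇒ X} {q : P ⇒ Y}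
                   {f' : Z ⇒ W} {g' : Y' ⇒ W} {q' : Y ⇒ Y'}
    → IsPullback C f g p q → IsPullback C f' g' g q'
    → IsPullback C (f' ∘ f) g' p (q' ∘ q)
  pullback-paste {Y' = Y'} {f = f} {g} {p} {q} {f'} {g'} {q'} inner outer =
    pullback-intro commutes factor separates
    where
      commutes : (f' ∘ f) ∘ p ≈ g' ∘ (q' ∘ q)
      commutes = ≈-trans assoc (≈-trans (refl⟩∘⟨ proj₁ inner) (extendʳ (proj₁ outer)))
      factor : ∀ {Q} (h : Q ⇒ _) (k : Q ⇒ Y') → (f' ∘ f) ∘ h ≈ g' ∘ k
             → Factorisation p (q' ∘ q) h k
      factor h k eq =
        let (v , gv≈fh , q'v≈k) = pullback-factor outer (≈-trans sym-assoc eq)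
            (u , pu≈h , qu≈v)   = pullback-factor inner (≈-sym gv≈fh)
        in u , pu≈h , ≈-trans assoc (≈-trans (refl⟩∘⟨ qu≈v) q'v≈k)
      separates : JointlyMonicSpan p (q' ∘ q)
      separates s t ps≈pt q'qs≈q'qt = pullback-separates inner s t ps≈pt qs≈qt
        where
          gqs≈gqt : g ∘ (q ∘ s) ≈ g ∘ (q ∘ t)
          gqs≈gqt = ≈-trans (extendʳ (≈-sym (proj₁ inner)))
                      (≈-trans (refl⟩∘⟨ ps≈pt) (extendʳ (proj₁ inner)))
          qs≈qt : q ∘ s ≈ q ∘ t
          qs≈qt = pullback-separates outer (q ∘ s) (q ∘ t) gqs≈gqt
                    (≈-trans sym-assoc (≈-trans q'qs≈q'qt assoc))

module CoproductFacts {o ℓ e : Level} (C : Category o ℓ e) (coproducts : FiniteCoproducts C) where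
  open Category C
  open CategoryFacts C
  open FiniteCoproducts coproducts

  ∘-cotuple : ∀ {A B D E} {f : A ⇒ D} {g : B ⇒ D} {h : D ⇒ E} → h ∘ [ f , g ] ≈ [ h ∘ f , h ∘ g ]
  ∘-cotuple = unique _ (≈-trans assoc (refl⟩∘⟨ inject₁)) (≈-trans assoc (refl⟩∘⟨ inject₂))

  cotuple-cong : ∀ {A B D} {f f' : A ⇒ D} {g g' : B ⇒ D}
               → f ≈ f' → g ≈ g' → [ f , g ] ≈ [ f' , g' ]
  cotuple-cong f≈f' g≈g' = unique _ (≈-trans inject₁ f≈f') (≈-trans inject₂ g≈g')

  cotuple-κ₁ : ∀ {A B D Q} {f : A ⇒ D} {g : B ⇒ D} {x : Q ⇒ A} → [ f , g ] ∘ (κ₁ ∘ x) ≈ f ∘ x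
  cotuple-κ₁ = pullˡ inject₁

  cotuple-κ₂ : ∀ {A B D Q} {f : A ⇒ D} {g : B ⇒ D} {x : Q ⇒ B} → [ f , g ] ∘ (κ₂ ∘ x) ≈ g ∘ x
  cotuple-κ₂ = pullˡ inject₂

  ⊕-κ₁ : ∀ {A B X Y Q} {f : A ⇒ B} {g : X ⇒ Y} {x : Q ⇒ A} → (f ⊕ g) ∘ (κ₁ ∘ x) ≈ κ₁ ∘ (f ∘ x)
  ⊕-κ₁ = ≈-trans cotuple-κ₁ assoc

  ⊕-κ₂ : ∀ {A B X Y Q} {f : A ⇒ B} {g : X ⇒ Y} {x : Q ⇒ X} → (f ⊕ g) ∘ (κ₂ ∘ x) ≈ κ₂ ∘ (g ∘ x)
  ⊕-κ₂ = ≈-trans cotuple-κ₂ assoc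

module ExtensiveFacts {o ℓ e : Level} (C : Category o ℓ e) (Ext : Extensive C) where
  open Category C
  open CategoryFacts C
  open Extensive Ext
  open FiniteCoproducts coproducts
  open CoproductFacts C coproducts

  record Decomposition {Q X Y : Obj} (h : Q ⇒ X + Y) : Set (o ⊔ ℓ ⊔ e) where
    field
      Q₁ Q₂     : Obj
      k₁        : Q₁ ⇒ Q
      k₂        : Q₂ ⇒ Q
      a₁        : Q₁ ⇒ X
      a₂        : Q₂ ⇒ Y
      pullback₁ : IsPullback C h κ₁ k₁ a₁
      pullback₂ : IsPullback C h κ₂ k₂ a₂
      jointly-epic : ∀ {B} (s t : Q ⇒ B) → s ∘ k₁ ≈ t ∘ k₁ → s ∘ k₂ ≈ t ∘ k₂ → s ≈ t
      glue : ∀ {B} (c₁ : Q₁ ⇒ B) (c₂ : Q₂ ⇒ B) → Σ[ c ∈ Q ⇒ B ] (c ∘ k₁ ≈ c₁ × c ∘ k₂ ≈ c₂)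

    h∘k₁ : h ∘ k₁ ≈ κ₁ ∘ a₁
    h∘k₁ = proj₁ pullback₁

    h∘k₂ : h ∘ k₂ ≈ κ₂ ∘ a₂
    h∘k₂ = proj₁ pullback₂

    section₁ : ∀ {x : Q ⇒ X} → h ≈ κ₁ ∘ x → Σ[ s ∈ Q ⇒ Q₁ ] (k₁ ∘ s ≈ id)
    section₁ eq = let (s , k₁s≈id , _) = pullback-factor pullback₁ (≈-trans identityʳ eq) in s , k₁s≈id

    section₂ : ∀ {x : Q ⇒ Y} → h ≈ κ₂ ∘ x → Σ[ s ∈ Q ⇒ Q₂ ] (k₂ ∘ s ≈ id)
    section₂ eq = let (s , k₂s≈id , _) = pullback-factor pullback₂ (≈-trans identityʳ eq) in s , k₂s≈id

    glue-factorisation : ∀ {P A B} {p : P ⇒ A} {q : P ⇒ B} {h₁ : Q ⇒ A} {h₂ : Q ⇒ B}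
      → Factorisation p q (h₁ ∘ k₁) (h₂ ∘ k₁) → Factorisation p q (h₁ ∘ k₂) (h₂ ∘ k₂)
      → Factorisation p q h₁ h₂
    glue-factorisation {P} (u₁ , pu₁ , qu₁) (u₂ , pu₂ , qu₂) with glue u₁ u₂
    ... | u , uk₁ , uk₂ =
      u , jointly-epic _ _ (restrict uk₁ pu₁) (restrict uk₂ pu₂)
        , jointly-epic _ _ (restrict uk₁ qu₁) (restrict uk₂ qu₂)
      where
        restrict : ∀ {K W} {k : K ⇒ Q} {v : K ⇒ P} {r : P ⇒ W} {x : Q ⇒ W}
                 → u ∘ k ≈ v → r ∘ v ≈ x ∘ k → (r ∘ u) ∘ k ≈ x ∘ k
        restrict uk≈v rv≈xk = ≈-trans assoc (≈-trans (refl⟩∘⟨ uk≈v) rv≈xk)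

  decompose : ∀ {Q X Y} (h : Q ⇒ X + Y) → Decomposition h
  decompose {Q} h with universal h
  ... | Q₁ , k₁ , a₁ , Q₂ , k₂ , a₂ , pullback₁ , pullback₂ , j , j-left , j-right = record
    { Q₁ = Q₁ ; Q₂ = Q₂ ; k₁ = k₁ ; k₂ = k₂ ; a₁ = a₁ ; a₂ = a₂
    ; pullback₁ = pullback₁ ; pullback₂ = pullback₂
    ; jointly-epic = λ s t sk₁≈tk₁ sk₂≈tk₂ → split-epi-cancel j-right s t
        (≈-trans ∘-cotuple (≈-trans (cotuple-cong sk₁≈tk₁ sk₂≈tk₂) (≈-sym ∘-cotuple)))
    ; glue = λ c₁ c₂ → [ c₁ , c₂ ] ∘ j
        , ≈-trans assoc (≈-trans (refl⟩∘⟨ j∘κ-part inject₁) inject₁)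
        , ≈-trans assoc (≈-trans (refl⟩∘⟨ j∘κ-part inject₂) inject₂) }
    where
      j∘κ-part : ∀ {P} {k : P ⇒ Q} {κ : P ⇒ Q₁ + Q₂} → [ k₁ , k₂ ] ∘ κ ≈ k → j ∘ k ≈ κ
      j∘κ-part eq = ≈-trans (refl⟩∘⟨ ≈-sym eq) (≈-trans sym-assoc (≈-trans (j-left ⟩∘⟨refl) identityˡ))

  -- Both parts of the map W → I → W + W are all of W, so any a , b : W → B glue to a
  -- single map that restricts to a and to b.
  strict-initial : ∀ {W I} → IsInitial C I → W ⇒ I → IsInitial C W
  strict-initial {W} I-initial m B = proj₁ (I-initial B) ∘ m , λ g → maps-agree g _
    where
      open Decomposition (decompose (proj₁ (I-initial (W + W)) ∘ m))
      through-κ : ∀ {κ : W ⇒ W + W} → proj₁ (I-initial (W + W)) ∘ m ≈ κ ∘ (proj₁ (I-initial W) ∘ m)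
      through-κ = ≈-trans (initial-unique I-initial _ _ ⟩∘⟨refl) assoc
      maps-agree : (a b : W ⇒ B) → a ≈ b
      maps-agree a b =
        ≈-trans (split-epi-cancel (proj₂ (section₁ through-κ)) a c (≈-sym c∘k₁≈a∘k₁))
                (split-epi-cancel (proj₂ (section₂ through-κ)) c b c∘k₂≈b∘k₂)
        where
          glued : Σ[ c ∈ W ⇒ B ] (c ∘ k₁ ≈ a ∘ k₁ × c ∘ k₂ ≈ b ∘ k₂)
          glued = glue (a ∘ k₁) (b ∘ k₂)
          c : W ⇒ B
          c = proj₁ glued
          c∘k₁≈a∘k₁ : c ∘ k₁ ≈ a ∘ k₁
          c∘k₁≈a∘k₁ = proj₁ (proj₂ glued)
          c∘k₂≈b∘k₂ : c ∘ k₂ ≈ b ∘ k₂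
          c∘k₂≈b∘k₂ = proj₂ (proj₂ glued)

  disjoint-initial : ∀ {W A B} {x : W ⇒ A} {y : W ⇒ B} → κ₁ ∘ x ≈ κ₂ ∘ y → IsInitial C W
  disjoint-initial {A = A} {B} eq with disjoint {A} {B}
  ... | _ , _ , _ , pb , P-initial = strict-initial P-initial (proj₁ (pullback-factor pb eq))

  factors-through-κ₁ : ∀ {Q X Y} {h : Q ⇒ X + Y} (D : Decomposition h)
    → IsInitial C (Decomposition.Q₂ D) → Σ[ a ∈ Q ⇒ X ] (h ≈ κ₁ ∘ a)
  factors-through-κ₁ {h = h} D Q₂-initial with Decomposition.glue D (Decomposition.a₁ D) (proj₁ (Q₂-initial _))
  ... | a , a∘k₁≈a₁ , _ =
    a , jointly-epic h (κ₁ ∘ a) (≈-trans h∘k₁ (≈-trans (refl⟩∘⟨ ≈-sym a∘k₁≈a₁) sym-assoc))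
                                (initial-unique Q₂-initial _ _)
    where open Decomposition D

  factors-through-κ₂ : ∀ {Q X Y} {h : Q ⇒ X + Y} (D : Decomposition h)
    → IsInitial C (Decomposition.Q₁ D) → Σ[ a ∈ Q ⇒ Y ] (h ≈ κ₂ ∘ a)
  factors-through-κ₂ {h = h} D Q₁-initial with Decomposition.glue D (proj₁ (Q₁-initial _)) (Decomposition.a₂ D)
  ... | a , _ , a∘k₂≈a₂ =
    a , jointly-epic h (κ₂ ∘ a) (initial-unique Q₁-initial _ _)
                                (≈-trans h∘k₂ (≈-trans (refl⟩∘⟨ ≈-sym a∘k₂≈a₂) sym-assoc))
    where open Decomposition D

  -- (K+) for the first summand: κ₁ pulled back along f ⊕ g is κ₁. If (f ⊕ g) ∘ h lands
  -- in the first summand, the second part of h maps into both summands, so is initial.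
  κ₁-pullback : ∀ {X Y A B} {f : X ⇒ Y} {g : A ⇒ B} → IsPullback C κ₁ (f ⊕ g) f κ₁
  κ₁-pullback {X} {Y} {A} {f = f} {g} = pullback-intro (≈-sym inject₁) factor (λ s t _ → κ₁-monic s t)
    where
      factor : ∀ {Q} (c : Q ⇒ Y) (h : Q ⇒ X + A) → κ₁ ∘ c ≈ (f ⊕ g) ∘ h → Factorisation f κ₁ c h
      factor {Q} c h eq = a , f∘a≈c , ≈-sym h≈κ₁a
        where
          open Decomposition (decompose h)
          second-part-in-both : κ₁ ∘ (c ∘ k₂) ≈ κ₂ ∘ (g ∘ a₂)
          second-part-in-both = ≈-trans (extendʳ eq) (≈-trans (refl⟩∘⟨ h∘k₂) ⊕-κ₂)
          in-first : Σ[ a ∈ Q ⇒ X ] (h ≈ κ₁ ∘ a)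
          in-first = factors-through-κ₁ (decompose h) (disjoint-initial second-part-in-both)
          a : Q ⇒ X
          a = proj₁ in-first
          h≈κ₁a : h ≈ κ₁ ∘ a
          h≈κ₁a = proj₂ in-first
          f∘a≈c : f ∘ a ≈ c
          f∘a≈c = κ₁-monic _ _ (≈-trans (≈-sym ⊕-κ₁) (≈-trans (refl⟩∘⟨ ≈-sym h≈κ₁a) (≈-sym eq)))

  κ₂-pullback : ∀ {X Y A B} {f : X ⇒ Y} {g : A ⇒ B} → IsPullback C κ₂ (f ⊕ g) g κ₂
  κ₂-pullback {X} {A = A} {B} {f} {g} = pullback-intro (≈-sym inject₂) factor (λ s t _ → κ₂-monic s t)
    where
      factor : ∀ {Q} (c : Q ⇒ B) (h : Q ⇒ X + A) → κ₂ ∘ c ≈ (f ⊕ g) ∘ h → Factorisation g κ₂ c h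
      factor {Q} c h eq = a , g∘a≈c , ≈-sym h≈κ₂a
        where
          open Decomposition (decompose h)
          first-part-in-both : κ₁ ∘ (f ∘ a₁) ≈ κ₂ ∘ (c ∘ k₁)
          first-part-in-both = ≈-sym (≈-trans (extendʳ eq) (≈-trans (refl⟩∘⟨ h∘k₁) ⊕-κ₁))
          in-second : Σ[ a ∈ Q ⇒ A ] (h ≈ κ₂ ∘ a)
          in-second = factors-through-κ₂ (decompose h) (disjoint-initial first-part-in-both)
          a : Q ⇒ A
          a = proj₁ in-second
          h≈κ₂a : h ≈ κ₂ ∘ a
          h≈κ₂a = proj₂ in-second
          g∘a≈c : g ∘ a ≈ c
          g∘a≈c = κ₂-monic _ _ (≈-trans (≈-sym ⊕-κ₂) (≈-trans (refl⟩∘⟨ ≈-sym h≈κ₂a) (≈-sym eq)))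

  module _ {A B X Z P₁ P₂ : Obj} {α : A ⇒ Z} {β : B ⇒ Z} {f : X ⇒ Z}
           {p₁ : P₁ ⇒ A} {q₁ : P₁ ⇒ X} {p₂ : P₂ ⇒ B} {q₂ : P₂ ⇒ X}
           (pb₁ : IsPullback C α f p₁ q₁) (pb₂ : IsPullback C β f p₂ q₂) where

    -- A cone over ([α , β] , f) factors through the coproduct of the two pullbacks:
    -- split its domain along the map into A + B and factor each part separately.
    cotuple-pullback-factor : ∀ {Q} (h : Q ⇒ A + B) (k : Q ⇒ X) → [ α , β ] ∘ h ≈ f ∘ k
      → Factorisation (p₁ ⊕ p₂) [ q₁ , q₂ ] h k
    cotuple-pullback-factor h k eq = glue-factorisation on-Q₁ on-Q₂
      where
        open Decomposition (decompose h)
        on-Q₁ : Factorisation (p₁ ⊕ p₂) [ q₁ , q₂ ] (h ∘ k₁) (k ∘ k₁)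
        on-Q₁ with pullback-factor pb₁ (begin
          α ∘ a₁                  ≈⟨ ≈-sym cotuple-κ₁ ⟩
          [ α , β ] ∘ (κ₁ ∘ a₁)  ≈⟨ refl⟩∘⟨ ≈-sym h∘k₁ ⟩
          [ α , β ] ∘ (h ∘ k₁)   ≈⟨ extendʳ eq ⟩
          f ∘ (k ∘ k₁)           ∎)
        ... | u , p₁u≈a₁ , q₁u≈kk₁ =
          κ₁ ∘ u , ≈-trans ⊕-κ₁ (≈-trans (refl⟩∘⟨ p₁u≈a₁) (≈-sym h∘k₁)) , ≈-trans cotuple-κ₁ q₁u≈kk₁
        on-Q₂ : Factorisation (p₁ ⊕ p₂) [ q₁ , q₂ ] (h ∘ k₂) (k ∘ k₂)
        on-Q₂ with pullback-factor pb₂ (begin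
          β ∘ a₂                  ≈⟨ ≈-sym cotuple-κ₂ ⟩
          [ α , β ] ∘ (κ₂ ∘ a₂)  ≈⟨ refl⟩∘⟨ ≈-sym h∘k₂ ⟩
          [ α , β ] ∘ (h ∘ k₂)   ≈⟨ extendʳ eq ⟩
          f ∘ (k ∘ k₂)           ∎)
        ... | u , p₂u≈a₂ , q₂u≈kk₂ =
          κ₂ ∘ u , ≈-trans ⊕-κ₂ (≈-trans (refl⟩∘⟨ p₂u≈a₂) (≈-sym h∘k₂)) , ≈-trans cotuple-κ₂ q₂u≈kk₂

    -- Maps s , t into P₁ + P₂ identified by p₁ ⊕ p₂ and [q₁ , q₂] agree: on the part
    -- where s lands in Pᵢ, so does t by (K+), and there the pullback Pᵢ separates them.
    cotuple-pullback-separates : JointlyMonicSpan (p₁ ⊕ p₂) [ q₁ , q₂ ]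
    cotuple-pullback-separates s t ps≈pt qs≈qt = jointly-epic s t on-Q₁ on-Q₂
      where
        open Decomposition (decompose s)
        t-in-first : Factorisation p₁ κ₁ (p₁ ∘ a₁) (t ∘ k₁)
        t-in-first = pullback-factor (κ₁-pullback {f = p₁} {g = p₂})
          (≈-trans (≈-sym ⊕-κ₁) (≈-trans (refl⟩∘⟨ ≈-sym h∘k₁) (extendʳ ps≈pt)))
        b₁ : Q₁ ⇒ P₁
        b₁ = proj₁ t-in-first
        q₁b₁≈q₁a₁ : q₁ ∘ b₁ ≈ q₁ ∘ a₁
        q₁b₁≈q₁a₁ = begin
          q₁ ∘ b₁                   ≈⟨ ≈-sym cotuple-κ₁ ⟩
          [ q₁ , q₂ ] ∘ (κ₁ ∘ b₁)  ≈⟨ refl⟩∘⟨ proj₂ (proj₂ t-in-first) ⟩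
          [ q₁ , q₂ ] ∘ (t ∘ k₁)   ≈⟨ extendʳ (≈-sym qs≈qt) ⟩
          [ q₁ , q₂ ] ∘ (s ∘ k₁)   ≈⟨ refl⟩∘⟨ h∘k₁ ⟩
          [ q₁ , q₂ ] ∘ (κ₁ ∘ a₁)  ≈⟨ cotuple-κ₁ ⟩
          q₁ ∘ a₁                   ∎
        on-Q₁ : s ∘ k₁ ≈ t ∘ k₁
        on-Q₁ = begin
          s ∘ k₁   ≈⟨ h∘k₁ ⟩
          κ₁ ∘ a₁  ≈⟨ refl⟩∘⟨ pullback-separates pb₁ a₁ b₁ (≈-sym (proj₁ (proj₂ t-in-first)))
                                                        (≈-sym q₁b₁≈q₁a₁) ⟩
          κ₁ ∘ b₁  ≈⟨ proj₂ (proj₂ t-in-first) ⟩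
          t ∘ k₁   ∎
        t-in-second : Factorisation p₂ κ₂ (p₂ ∘ a₂) (t ∘ k₂)
        t-in-second = pullback-factor (κ₂-pullback {f = p₁} {g = p₂})
          (≈-trans (≈-sym ⊕-κ₂) (≈-trans (refl⟩∘⟨ ≈-sym h∘k₂) (extendʳ ps≈pt)))
        b₂ : Q₂ ⇒ P₂
        b₂ = proj₁ t-in-second
        q₂b₂≈q₂a₂ : q₂ ∘ b₂ ≈ q₂ ∘ a₂
        q₂b₂≈q₂a₂ = begin
          q₂ ∘ b₂                   ≈⟨ ≈-sym cotuple-κ₂ ⟩
          [ q₁ , q₂ ] ∘ (κ₂ ∘ b₂)  ≈⟨ refl⟩∘⟨ proj₂ (proj₂ t-in-second) ⟩
          [ q₁ , q₂ ] ∘ (t ∘ k₂)   ≈⟨ extendʳ (≈-sym qs≈qt) ⟩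
          [ q₁ , q₂ ] ∘ (s ∘ k₂)   ≈⟨ refl⟩∘⟨ h∘k₂ ⟩
          [ q₁ , q₂ ] ∘ (κ₂ ∘ a₂)  ≈⟨ cotuple-κ₂ ⟩
          q₂ ∘ a₂                   ∎
        on-Q₂ : s ∘ k₂ ≈ t ∘ k₂
        on-Q₂ = begin
          s ∘ k₂   ≈⟨ h∘k₂ ⟩
          κ₂ ∘ a₂  ≈⟨ refl⟩∘⟨ pullback-separates pb₂ a₂ b₂ (≈-sym (proj₁ (proj₂ t-in-second)))
                                                        (≈-sym q₂b₂≈q₂a₂) ⟩
          κ₂ ∘ b₂  ≈⟨ proj₂ (proj₂ t-in-second) ⟩
          t ∘ k₂   ∎

    cotuple-pullback : IsPullback C [ α , β ] f (p₁ ⊕ p₂) [ q₁ , q₂ ]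
    cotuple-pullback = pullback-intro commutes cotuple-pullback-factor cotuple-pullback-separates
      where
        commutes : [ α , β ] ∘ (p₁ ⊕ p₂) ≈ f ∘ [ q₁ , q₂ ]
        commutes = begin
          [ α , β ] ∘ (p₁ ⊕ p₂)                                  ≈⟨ ∘-cotuple ⟩
          [ [ α , β ] ∘ (κ₁ ∘ p₁) , [ α , β ] ∘ (κ₂ ∘ p₂) ]     ≈⟨ cotuple-cong cotuple-κ₁ cotuple-κ₂ ⟩
          [ α ∘ p₁ , β ∘ p₂ ]                                   ≈⟨ cotuple-cong (proj₁ pb₁) (proj₁ pb₂) ⟩
          [ f ∘ q₁ , f ∘ q₂ ]                                   ≈⟨ ≈-sym ∘-cotuple ⟩
          f ∘ [ q₁ , q₂ ]                                       ∎

  -- A coproduct of two pullback squares is a pullback square: f₁ ⊕ f₂ is the cotuple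
  -- of κ₁ ∘ f₁ and κ₂ ∘ f₂, whose pullbacks are obtained by pasting with (K+).
  ⊕-pullback : ∀ {X₁ Y₁ Z₁ P₁ X₂ Y₂ Z₂ P₂}
      {f₁ : X₁ ⇒ Z₁} {g₁ : Y₁ ⇒ Z₁} {p₁ : P₁ ⇒ X₁} {q₁ : P₁ ⇒ Y₁}
      {f₂ : X₂ ⇒ Z₂} {g₂ : Y₂ ⇒ Z₂} {p₂ : P₂ ⇒ X₂} {q₂ : P₂ ⇒ Y₂}
    → IsPullback C f₁ g₁ p₁ q₁ → IsPullback C f₂ g₂ p₂ q₂
    → IsPullback C (f₁ ⊕ f₂) (g₁ ⊕ g₂) (p₁ ⊕ p₂) (q₁ ⊕ q₂)
  ⊕-pullback pb₁ pb₂ =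
    cotuple-pullback (pullback-paste pb₁ κ₁-pullback) (pullback-paste pb₂ κ₂-pullback)

  squareK+ : SquareK+ C Ext
  squareK+ f g = κ₁-pullback

  squareK : SquareK C Ext
  squareK f A = κ₁-pullback

  squareD : SquareD C Ext
  squareD f = cotuple-pullback (pullback-swap identity-pullback) (pullback-swap identity-pullback)

  squareD+ : SquareD+ C Ext
  squareD+ f = ⊕-pullback (squareD f) (pullback-swap identity-pullback)

  squareE : SquareE C Ext
  squareE f g = ⊕-pullback identity-pullback (pullback-swap identity-pullback)

  -- Where [id , κ₂] ∘ w lands in the first summand, w is determined by [id , κ₂] ∘ w:
  -- the second part of w is initial, so w lies in the first summand, where [id , κ₂]
  -- is the identity.
  first-summand-determined : ∀ {Q A B} {w : Q ⇒ (A + B) + B} {a : Q ⇒ A}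
    → [ id , κ₂ ] ∘ w ≈ κ₁ ∘ a → w ≈ κ₁ ∘ ([ id , κ₂ ] ∘ w)
  first-summand-determined {Q} {A} {B} {w} {a} eq = begin
    w                            ≈⟨ w≈κ₁b ⟩
    κ₁ ∘ b                       ≈⟨ refl⟩∘⟨ ≈-sym (≈-trans cotuple-κ₁ identityˡ) ⟩
    κ₁ ∘ ([ id , κ₂ ] ∘ (κ₁ ∘ b)) ≈⟨ refl⟩∘⟨ refl⟩∘⟨ ≈-sym w≈κ₁b ⟩
    κ₁ ∘ ([ id , κ₂ ] ∘ w)       ∎
    where
      open Decomposition (decompose w)
      second-part-in-both : κ₁ ∘ (a ∘ k₂) ≈ κ₂ ∘ a₂
      second-part-in-both = ≈-trans (extendʳ (≈-sym eq)) (≈-trans (refl⟩∘⟨ h∘k₂) cotuple-κ₂)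
      in-first : Σ[ b ∈ Q ⇒ A + B ] (w ≈ κ₁ ∘ b)
      in-first = factors-through-κ₁ (decompose w) (disjoint-initial second-part-in-both)
      b : Q ⇒ A + B
      b = proj₁ in-first
      w≈κ₁b : w ≈ κ₁ ∘ b
      w≈κ₁b = proj₂ in-first

  -- Where [id , κ₂] ∘ w lands in the second summand, w is determined by
  -- [[κ₂ , κ₁] , κ₂] ∘ w: w misses the first copy of X, and on the other two copies
  -- (κ₂ ⊕ id) ∘ [[κ₂ , κ₁] , κ₂] is the identity.
  second-summand-determined : ∀ {Q X} {w : Q ⇒ (X + X) + X} {a : Q ⇒ X}
    → [ id , κ₂ ] ∘ w ≈ κ₂ ∘ a → w ≈ (κ₂ ⊕ id) ∘ ([ [ κ₂ , κ₁ ] , κ₂ ] ∘ w)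
  second-summand-determined {Q} {X} {w} {a} eq = jointly-epic _ _ on-Q₁ on-Q₂
    where
      open Decomposition (decompose w)
      r : Q ⇒ (X + X) + X
      r = (κ₂ ⊕ id) ∘ ([ [ κ₂ , κ₁ ] , κ₂ ] ∘ w)
      r-restrict : ∀ {K} {k : K ⇒ Q} → r ∘ k ≈ (κ₂ ⊕ id) ∘ ([ [ κ₂ , κ₁ ] , κ₂ ] ∘ (w ∘ k))
      r-restrict = ≈-trans assoc (refl⟩∘⟨ assoc)
      a₁-in-second : a₁ ≈ κ₂ ∘ (a ∘ k₁)
      a₁-in-second = ≈-trans (≈-sym (≈-trans cotuple-κ₁ identityˡ))
                       (≈-trans (refl⟩∘⟨ ≈-sym h∘k₁) (extendʳ eq))
      on-Q₁ : w ∘ k₁ ≈ r ∘ k₁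
      on-Q₁ = begin
        w ∘ k₁                                                   ≈⟨ h∘k₁ ⟩
        κ₁ ∘ a₁                                                  ≈⟨ refl⟩∘⟨ a₁-in-second ⟩
        κ₁ ∘ (κ₂ ∘ (a ∘ k₁))                                     ≈⟨ ≈-sym ⊕-κ₁ ⟩
        (κ₂ ⊕ id) ∘ (κ₁ ∘ (a ∘ k₁))                              ≈⟨ refl⟩∘⟨ ≈-sym cotuple-κ₂ ⟩
        (κ₂ ⊕ id) ∘ ([ κ₂ , κ₁ ] ∘ (κ₂ ∘ (a ∘ k₁)))              ≈⟨ refl⟩∘⟨ refl⟩∘⟨ ≈-sym a₁-in-second ⟩
        (κ₂ ⊕ id) ∘ ([ κ₂ , κ₁ ] ∘ a₁)                           ≈⟨ refl⟩∘⟨ ≈-sym cotuple-κ₁ ⟩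
        (κ₂ ⊕ id) ∘ ([ [ κ₂ , κ₁ ] , κ₂ ] ∘ (κ₁ ∘ a₁))          ≈⟨ refl⟩∘⟨ refl⟩∘⟨ ≈-sym h∘k₁ ⟩
        (κ₂ ⊕ id) ∘ ([ [ κ₂ , κ₁ ] , κ₂ ] ∘ (w ∘ k₁))           ≈⟨ ≈-sym r-restrict ⟩
        r ∘ k₁                                                   ∎
      on-Q₂ : w ∘ k₂ ≈ r ∘ k₂
      on-Q₂ = begin
        w ∘ k₂                                                   ≈⟨ h∘k₂ ⟩
        κ₂ ∘ a₂                                                  ≈⟨ refl⟩∘⟨ ≈-sym identityˡ ⟩
        κ₂ ∘ (id ∘ a₂)                                           ≈⟨ ≈-sym ⊕-κ₂ ⟩
        (κ₂ ⊕ id) ∘ (κ₂ ∘ a₂)                                    ≈⟨ refl⟩∘⟨ ≈-sym cotuple-κ₂ ⟩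
        (κ₂ ⊕ id) ∘ ([ [ κ₂ , κ₁ ] , κ₂ ] ∘ (κ₂ ∘ a₂))          ≈⟨ refl⟩∘⟨ refl⟩∘⟨ ≈-sym h∘k₂ ⟩
        (κ₂ ⊕ id) ∘ ([ [ κ₂ , κ₁ ] , κ₂ ] ∘ (w ∘ k₂))           ≈⟨ ≈-sym r-restrict ⟩
        r ∘ k₂                                                   ∎

  joint-monicity : ∀ X → JointlyMonic C Ext [ id , κ₂ {X} {X} ] [ [ κ₂ {X} {X} , κ₁ ] , κ₂ ]
  joint-monicity X {W} u v m₁u≈m₁v m₂u≈m₂v = jointly-epic u v on-Q₁ on-Q₂
    where
      open Decomposition (decompose ([ id , κ₂ ] ∘ u))
      m₁-restrict : ∀ {K} {k : K ⇒ W} {x : K ⇒ X + X} {w : W ⇒ (X + X) + X}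
        → [ id , κ₂ ] ∘ w ≈ [ id , κ₂ ] ∘ u → ([ id , κ₂ ] ∘ u) ∘ k ≈ x → [ id , κ₂ ] ∘ (w ∘ k) ≈ x
      m₁-restrict w≈u uk≈x = ≈-trans sym-assoc (≈-trans (w≈u ⟩∘⟨refl) uk≈x)
      on-Q₁ : u ∘ k₁ ≈ v ∘ k₁
      on-Q₁ = begin
        u ∘ k₁                            ≈⟨ first-summand-determined (m₁-restrict ≈-refl h∘k₁) ⟩
        κ₁ ∘ ([ id , κ₂ ] ∘ (u ∘ k₁))     ≈⟨ refl⟩∘⟨ extendʳ m₁u≈m₁v ⟩
        κ₁ ∘ ([ id , κ₂ ] ∘ (v ∘ k₁))     ≈⟨ ≈-sym (first-summand-determined (m₁-restrict (≈-sym m₁u≈m₁v) h∘k₁)) ⟩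
        v ∘ k₁                            ∎
      on-Q₂ : u ∘ k₂ ≈ v ∘ k₂
      on-Q₂ = begin
        u ∘ k₂                                          ≈⟨ second-summand-determined (m₁-restrict ≈-refl h∘k₂) ⟩
        (κ₂ ⊕ id) ∘ ([ [ κ₂ , κ₁ ] , κ₂ ] ∘ (u ∘ k₂))  ≈⟨ refl⟩∘⟨ extendʳ m₂u≈m₂v ⟩
        (κ₂ ⊕ id) ∘ ([ [ κ₂ , κ₁ ] , κ₂ ] ∘ (v ∘ k₂))  ≈⟨ ≈-sym (second-summand-determined (m₁-restrict (≈-sym m₁u≈m₁v) h∘k₂)) ⟩
        v ∘ k₂                                          ∎

lemma2p2 : ∀ {o ℓ e : Level} (C : Category o ℓ e) (Ext : Extensive C) →
    (SquareE C Ext × SquareK C Ext × SquareK+ C Ext × SquareD C Ext × SquareD+ C Ext)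
    × (∀ (X : Category.Obj C) →
         JointlyMonic C Ext
           (FiniteCoproducts.[_,_] (Extensive.coproducts Ext)
              (Category.id C)
              (FiniteCoproducts.κ₂ (Extensive.coproducts Ext) {X} {X}))
           (FiniteCoproducts.[_,_] (Extensive.coproducts Ext)
              (FiniteCoproducts.[_,_] (Extensive.coproducts Ext)
                 (FiniteCoproducts.κ₂ (Extensive.coproducts Ext) {X} {X})
                 (FiniteCoproducts.κ₁ (Extensive.coproducts Ext) {X} {X}))
              (FiniteCoproducts.κ₂ (Extensive.coproducts Ext) {X} {X})))
lemma2p2 C Ext = (squareE , squareK , squareK+ , squareD , squareD+) , joint-monicity
  where open ExtensiveFacts C Ext
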